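{- Every positive integer $n\equiv 4\pmod 5$ that is a sum of three squares of integers is a sum of three nonunit squares, except for $n=14$ and $n=19$.
   Context: A positive integer $n$ is called a sum of three nonunit squares if there exist integers $x,y,z$ with $n=x^2+y^2+z^2$ and $(x^2-1)(y^2-1)(z^2-1)\neq 0$ (zero is allowed as a value of $x,y,z$). -}

module Defs where

open import Data.Nat using (ℕ)
open import Data.Integer using (ℤ; +_; _+_; _*_; _-_)
open import Data.Product using (∃-syntax; _×_)
open import Relation.Binary.PropositionalEquality using (_≡_; _≢_)

SumOfThreeSquares : ℕ → Set
SumOfThreeSquares n = ∃[ x ] ∃[ y ] ∃[ z ] (+ n ≡ x * x + y * y + z * z)

SumOfThreeNonunitSquares : ℕ → Set
SumOfThreeNonunitSquares n =
  ∃[ x ] ∃[ y ] ∃[ z ]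
    ((+ n ≡ x * x + y * y + z * z) ×
     ((x * x - + 1) * (y * y - + 1) * (z * z - + 1) ≢ + 0))

-- If n = a² + b² + c² with, say, a = ±1, then b² + c² ≡ 3 (mod 5), which forces
-- b ≡ c ≡ ±2 (mod 5). Writing b = r + 5k with r ∈ {2, 3} and k ≥ 1, the identities
--   1 + (2 + 5k)² = (4k + 1)² + (3k + 2)²,   1 + (3 + 5k)² = (4k + 3)² + (3k + 1)²
-- absorb the unit square into two nonunit ones. Only b, c ∈ {2, 3} remain, i.e.
-- n ∈ {9, 14, 19}; here 9 = 0² + 0² + 3², while 14 and 19 are checked by exhaustive
-- search, the summands being below 5.
module Submission where

open import Defs
open import Data.Nat using (ℕ; _<_; _%_)
open import Data.Product using (_×_)
open import Relation.Nullary using (¬_)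
open import Relation.Binary.PropositionalEquality using (_≡_; _≢_)

open import Data.Nat using (zero; suc; _+_; _*_; _/_; _≟_; _<?_)
open import Data.Nat.Properties
  using (≰⇒>; <⇒≱; *-mono-≤; ≤-trans; ≤-<-trans; m≤m+n; m≤n+m; m*n≡1⇒m≡1; +-identityʳ; allUpTo?; anyUpTo?)
open import Data.Nat.DivMod using (m≡m%n+[m/n]*n; m%n<n; [m+kn]%n≡m%n)
open import Data.Nat.Tactic.RingSolver using (solve-∀)
open import Data.Integer as ℤ using (ℤ; +_; -[1+_]; ∣_∣)
import Data.Integer.Properties as ℤₚ
open import Data.Product using (∃; ∃-syntax; _,_)
open import Data.Sum using (_⊎_; inj₁; inj₂; [_,_]′)
open import Data.Empty using (⊥-elim)
open import Function using (_∘_)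
open import Function.Bundles using (_⇔_; mk⇔; Equivalence)
open import Relation.Nullary using (Dec; yes; no; ¬?)
open import Relation.Nullary.Decidable using (_×-dec_; _⊎-dec_; _→-dec_; from-yes; from-no)
open import Relation.Binary.PropositionalEquality using (refl; sym; trans; cong; cong₂; subst; module ≡-Reasoning)

NonunitRepresentation : ℕ → ℕ → ℕ → ℕ → Set
NonunitRepresentation n a b c = (n ≡ a * a + b * b + c * c) × a ≢ 1 × b ≢ 1 × c ≢ 1

NonunitSquares₃ : ℕ → Set
NonunitSquares₃ n = ∃[ a ] ∃[ b ] ∃[ c ] NonunitRepresentation n a b c

NonunitSquares₂ : ℕ → Set
NonunitSquares₂ n = ∃[ a ] ∃[ b ] (n ≡ a * a + b * b) × a ≢ 1 × b ≢ 1

TwoOrThree : ℕ → Set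
TwoOrThree r = r ≡ 2 ⊎ r ≡ 3

twoOrThree? : ∀ r → Dec (TwoOrThree r)
twoOrThree? r = (r ≟ 2) ⊎-dec (r ≟ 3)

i*i≡+∣i∣*∣i∣ : ∀ i → i ℤ.* i ≡ + (∣ i ∣ * ∣ i ∣)
i*i≡+∣i∣*∣i∣ (+ n)    = sym (ℤₚ.pos-* n n)
i*i≡+∣i∣*∣i∣ -[1+ n ] = refl

sumOfSquares≡+ : ∀ x y z →
  x ℤ.* x ℤ.+ y ℤ.* y ℤ.+ z ℤ.* z ≡ + (∣ x ∣ * ∣ x ∣ + ∣ y ∣ * ∣ y ∣ + ∣ z ∣ * ∣ z ∣)
sumOfSquares≡+ x y z = begin
  x ℤ.* x ℤ.+ y ℤ.* y ℤ.+ z ℤ.* z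
    ≡⟨ cong₂ ℤ._+_ (cong₂ ℤ._+_ (i*i≡+∣i∣*∣i∣ x) (i*i≡+∣i∣*∣i∣ y)) (i*i≡+∣i∣*∣i∣ z) ⟩
  + (∣ x ∣ * ∣ x ∣) ℤ.+ + (∣ y ∣ * ∣ y ∣) ℤ.+ + (∣ z ∣ * ∣ z ∣)
    ≡⟨ cong (ℤ._+ + (∣ z ∣ * ∣ z ∣)) (sym (ℤₚ.pos-+ (∣ x ∣ * ∣ x ∣) (∣ y ∣ * ∣ y ∣))) ⟩
  + (∣ x ∣ * ∣ x ∣ + ∣ y ∣ * ∣ y ∣) ℤ.+ + (∣ z ∣ * ∣ z ∣)
    ≡⟨ sym (ℤₚ.pos-+ (∣ x ∣ * ∣ x ∣ + ∣ y ∣ * ∣ y ∣) (∣ z ∣ * ∣ z ∣)) ⟩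
  + (∣ x ∣ * ∣ x ∣ + ∣ y ∣ * ∣ y ∣ + ∣ z ∣ * ∣ z ∣) ∎
  where open ≡-Reasoning

i*i-1≡0⇔∣i∣≡1 : ∀ i → (i ℤ.* i ℤ.- + 1 ≡ + 0) ⇔ (∣ i ∣ ≡ 1)
i*i-1≡0⇔∣i∣≡1 i = mk⇔ to from
  where
  to : i ℤ.* i ℤ.- + 1 ≡ + 0 → ∣ i ∣ ≡ 1
  to eq = m*n≡1⇒m≡1 ∣ i ∣ ∣ i ∣
    (ℤₚ.+-injective (trans (sym (i*i≡+∣i∣*∣i∣ i)) (ℤₚ.i-j≡0⇒i≡j _ _ eq)))
  from : ∣ i ∣ ≡ 1 → i ℤ.* i ℤ.- + 1 ≡ + 0
  from ∣i∣≡1 = cong (ℤ._- + 1) (trans (i*i≡+∣i∣*∣i∣ i) (cong (λ m → + (m * m)) ∣i∣≡1))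

i*j*k≢0⇔ : ∀ i j k → (i ℤ.* j ℤ.* k ≢ + 0) ⇔ (i ≢ + 0 × j ≢ + 0 × k ≢ + 0)
i*j*k≢0⇔ i j k = mk⇔ to from
  where
  to : i ℤ.* j ℤ.* k ≢ + 0 → i ≢ + 0 × j ≢ + 0 × k ≢ + 0
  to ijk≢0 =
      (λ i≡0 → ijk≢0 (cong (λ t → t ℤ.* j ℤ.* k) i≡0))
    , (λ j≡0 → ijk≢0 (trans (cong (λ t → i ℤ.* t ℤ.* k) j≡0) (cong (ℤ._* k) (ℤₚ.*-zeroʳ i))))
    , (λ k≡0 → ijk≢0 (trans (cong (i ℤ.* j ℤ.*_) k≡0) (ℤₚ.*-zeroʳ (i ℤ.* j))))
  from : i ≢ + 0 × j ≢ + 0 × k ≢ + 0 → i ℤ.* j ℤ.* k ≢ + 0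
  from (i≢0 , j≢0 , k≢0) ijk≡0 with ℤₚ.i*j≡0⇒i≡0∨j≡0 (i ℤ.* j) ijk≡0
  ... | inj₂ k≡0 = k≢0 k≡0
  ... | inj₁ ij≡0 = [ i≢0 , j≢0 ]′ (ℤₚ.i*j≡0⇒i≡0∨j≡0 i ij≡0)

nonunitProduct≢0⇔ : ∀ x y z →
  ((x ℤ.* x ℤ.- + 1) ℤ.* (y ℤ.* y ℤ.- + 1) ℤ.* (z ℤ.* z ℤ.- + 1) ≢ + 0)
    ⇔ (∣ x ∣ ≢ 1 × ∣ y ∣ ≢ 1 × ∣ z ∣ ≢ 1)
nonunitProduct≢0⇔ x y z = mk⇔
  (λ p≢0 → let (x≢ , y≢ , z≢) = Product.to p≢0 in
    x≢ ∘ Unit.from x , y≢ ∘ Unit.from y , z≢ ∘ Unit.from z)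
  (λ (x≢ , y≢ , z≢) → Product.from (x≢ ∘ Unit.to x , y≢ ∘ Unit.to y , z≢ ∘ Unit.to z))
  where
  module Product = Equivalence (i*j*k≢0⇔ (x ℤ.* x ℤ.- + 1) (y ℤ.* y ℤ.- + 1) (z ℤ.* z ℤ.- + 1))
  module Unit (i : ℤ) = Equivalence (i*i-1≡0⇔∣i∣≡1 i)

sumOfThreeSquares⇒ℕ : ∀ {n} → SumOfThreeSquares n → ∃[ a ] ∃[ b ] ∃[ c ] n ≡ a * a + b * b + c * c
sumOfThreeSquares⇒ℕ (x , y , z , eq) = ∣ x ∣ , ∣ y ∣ , ∣ z ∣ , ℤₚ.+-injective (trans eq (sumOfSquares≡+ x y z))

sumOfThreeNonunitSquares⇔ : ∀ n → SumOfThreeNonunitSquares n ⇔ NonunitSquares₃ n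
sumOfThreeNonunitSquares⇔ n = mk⇔
  (λ (x , y , z , eq , p≢0) →
    ∣ x ∣ , ∣ y ∣ , ∣ z ∣ , ℤₚ.+-injective (trans eq (sumOfSquares≡+ x y z))
          , Equivalence.to (nonunitProduct≢0⇔ x y z) p≢0)
  (λ (a , b , c , eq , units) →
    + a , + b , + c , trans (cong +_ eq) (sym (sumOfSquares≡+ (+ a) (+ b) (+ c)))
        , Equivalence.from (nonunitProduct≢0⇔ (+ a) (+ b) (+ c)) units)

sumOfSquares%5 : ∀ b c → (1 + b * b + c * c) % 5 ≡ (1 + b % 5 * (b % 5) + c % 5 * (c % 5)) % 5
sumOfSquares%5 b c = begin
  (1 + b * b + c * c) % 5
    ≡⟨ cong₂ (λ u v → (1 + u * u + v * v) % 5) (m≡m%n+[m/n]*n b 5) (m≡m%n+[m/n]*n c 5) ⟩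
  (1 + (r + q * 5) * (r + q * 5) + (s + p * 5) * (s + p * 5)) % 5
    ≡⟨ cong (_% 5) (expand r q s p) ⟩
  (1 + r * r + s * s + (q * (2 * r + q * 5) + p * (2 * s + p * 5)) * 5) % 5
    ≡⟨ [m+kn]%n≡m%n (1 + r * r + s * s) (q * (2 * r + q * 5) + p * (2 * s + p * 5)) 5 ⟩
  (1 + r * r + s * s) % 5 ∎
  where
  open ≡-Reasoning
  r = b % 5
  q = b / 5
  s = c % 5
  p = c / 5
  expand : ∀ r q s p → 1 + (r + q * 5) * (r + q * 5) + (s + p * 5) * (s + p * 5)
                     ≡ 1 + r * r + s * s + (q * (2 * r + q * 5) + p * (2 * s + p * 5)) * 5
  expand = solve-∀

residues-of-1+b²+c²≡4 : ∀ b c → (1 + b * b + c * c) % 5 ≡ 4 → TwoOrThree (b % 5) × TwoOrThree (c % 5)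
residues-of-1+b²+c²≡4 b c eq = table (m%n<n b 5) (m%n<n c 5) (trans (sym (sumOfSquares%5 b c)) eq)
  where
  table : ∀ {r} → r < 5 → ∀ {s} → s < 5 → (1 + r * r + s * s) % 5 ≡ 4 → TwoOrThree r × TwoOrThree s
  table = from-yes (allUpTo? (λ r → allUpTo? (λ s →
    ((1 + r * r + s * s) % 5 ≟ 4) →-dec (twoOrThree? r ×-dec twoOrThree? s)) 5) 5)

twoOrThree%5⇒≢1 : ∀ {b} → TwoOrThree (b % 5) → b ≢ 1
twoOrThree%5⇒≢1 r refl = [ (λ ()) , (λ ()) ]′ r

1+square-nonunitSquares₂ : ∀ {r} k → TwoOrThree r → NonunitSquares₂ (1 + (r + suc k * 5) * (r + suc k * 5))
1+square-nonunitSquares₂ k (inj₁ refl) = suc k * 4 + 1 , suc k * 3 + 2 , identity (suc k) , (λ ()) , (λ ())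
  where
  identity : ∀ k → 1 + (2 + k * 5) * (2 + k * 5) ≡ (k * 4 + 1) * (k * 4 + 1) + (k * 3 + 2) * (k * 3 + 2)
  identity = solve-∀
1+square-nonunitSquares₂ k (inj₂ refl) = suc k * 4 + 3 , suc k * 3 + 1 , identity (suc k) , (λ ()) , (λ ())
  where
  identity : ∀ k → 1 + (3 + k * 5) * (3 + k * 5) ≡ (k * 4 + 3) * (k * 4 + 3) + (k * 3 + 1) * (k * 3 + 1)
  identity = solve-∀

twoOrThree⊎1+square-nonunitSquares₂ :
  ∀ b → TwoOrThree (b % 5) → TwoOrThree b ⊎ NonunitSquares₂ (1 + b * b)
twoOrThree⊎1+square-nonunitSquares₂ b r with b / 5 | m≡m%n+[m/n]*n b 5
... | zero  | b≡r+0 = inj₁ (subst TwoOrThree (sym (trans b≡r+0 (+-identityʳ _))) r)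
... | suc k | b≡r+5k = inj₂ (subst (λ t → NonunitSquares₂ (1 + t * t)) (sym b≡r+5k) (1+square-nonunitSquares₂ k r))

nonunitSquares₃-of-1+b²+c² : ∀ b c → (1 + b * b + c * c) % 5 ≡ 4 →
  1 + b * b + c * c ≢ 14 → 1 + b * b + c * c ≢ 19 → NonunitSquares₃ (1 + b * b + c * c)
nonunitSquares₃-of-1+b²+c² b c eq ≢14 ≢19
  with residues-of-1+b²+c²≡4 b c eq
... | rb , rc
  with twoOrThree⊎1+square-nonunitSquares₂ b rb | twoOrThree⊎1+square-nonunitSquares₂ c rc
... | inj₂ (p , q , e , p≢1 , q≢1) | _ =
  p , q , c , cong (_+ c * c) e , p≢1 , q≢1 , twoOrThree%5⇒≢1 rc
... | _ | inj₂ (p , q , e , p≢1 , q≢1) =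
  p , q , b , trans (swap b c) (cong (_+ b * b) e) , p≢1 , q≢1 , twoOrThree%5⇒≢1 rb
  where
  swap : ∀ b c → 1 + b * b + c * c ≡ 1 + c * c + b * b
  swap = solve-∀
... | inj₁ (inj₁ refl) | inj₁ (inj₁ refl) = 0 , 0 , 3 , refl , (λ ()) , (λ ()) , (λ ())
... | inj₁ (inj₁ refl) | inj₁ (inj₂ refl) = ⊥-elim (≢14 refl)
... | inj₁ (inj₂ refl) | inj₁ (inj₁ refl) = ⊥-elim (≢14 refl)
... | inj₁ (inj₂ refl) | inj₁ (inj₂ refl) = ⊥-elim (≢19 refl)

nonunitSquares₃-of-squares : ∀ {n} a b c → n ≡ a * a + b * b + c * c → n % 5 ≡ 4 →
  n ≢ 14 → n ≢ 19 → NonunitSquares₃ n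
nonunitSquares₃-of-squares a b c refl eq ≢14 ≢19 with a ≟ 1 | b ≟ 1 | c ≟ 1
... | yes refl | _ | _ = nonunitSquares₃-of-1+b²+c² b c eq ≢14 ≢19
... | _ | yes refl | _ = subst NonunitSquares₃ (sym (rotate a 1 c))
  (nonunitSquares₃-of-1+b²+c² c a (subst (λ m → m % 5 ≡ 4) (rotate a 1 c) eq)
    (≢14 ∘ trans (rotate a 1 c)) (≢19 ∘ trans (rotate a 1 c)))
  where
  rotate : ∀ a b c → a * a + b * b + c * c ≡ b * b + c * c + a * a
  rotate = solve-∀
... | _ | _ | yes refl = subst NonunitSquares₃ (sym (rotate a b))
  (nonunitSquares₃-of-1+b²+c² a b (subst (λ m → m % 5 ≡ 4) (rotate a b) eq)
    (≢14 ∘ trans (rotate a b)) (≢19 ∘ trans (rotate a b)))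
  where
  rotate : ∀ a b → a * a + b * b + 1 ≡ 1 + a * a + b * b
  rotate = solve-∀
... | no a≢1 | no b≢1 | no c≢1 = a , b , c , refl , a≢1 , b≢1 , c≢1

square<⇒< : ∀ {a m} → a * a < m * m → a < m
square<⇒< a²<m² = ≰⇒> λ m≤a → <⇒≱ a²<m² (*-mono-≤ m≤a m≤a)

NonunitSquares₃Below : ℕ → ℕ → Set
NonunitSquares₃Below m n = ∃ λ a → a < m × ∃ λ b → b < m × ∃ λ c → c < m × NonunitRepresentation n a b c

nonunitSquares₃Below? : ∀ m n → Dec (NonunitSquares₃Below m n)
nonunitSquares₃Below? m n =
  anyUpTo? (λ a → anyUpTo? (λ b → anyUpTo? (λ c →
    (n ≟ a * a + b * b + c * c) ×-dec ¬? (a ≟ 1) ×-dec ¬? (b ≟ 1) ×-dec ¬? (c ≟ 1)) m) m) m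

nonunitSquares₃⇒Below : ∀ {m n} → n < m * m → NonunitSquares₃ n → NonunitSquares₃Below m n
nonunitSquares₃⇒Below n<m² (a , b , c , rep@(refl , _)) =
    a , square<⇒< (≤-<-trans (≤-trans (m≤m+n (a * a) (b * b)) (m≤m+n _ (c * c))) n<m²)
  , b , square<⇒< (≤-<-trans (≤-trans (m≤n+m (b * b) (a * a)) (m≤m+n _ (c * c))) n<m²)
  , c , square<⇒< (≤-<-trans (m≤n+m (c * c) _) n<m²)
  , rep

¬nonunitSquares₃-14 : ¬ NonunitSquares₃ 14
¬nonunitSquares₃-14 = from-no (nonunitSquares₃Below? 4 14) ∘ nonunitSquares₃⇒Below (from-yes (14 <? 16))

¬nonunitSquares₃-19 : ¬ NonunitSquares₃ 19
¬nonunitSquares₃-19 = from-no (nonunitSquares₃Below? 5 19) ∘ nonunitSquares₃⇒Below (from-yes (19 <? 25))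

theorem2p4 : ((n : ℕ) → 0 < n → n % 5 ≡ 4 → SumOfThreeSquares n →
    n ≢ 14 → n ≢ 19 → SumOfThreeNonunitSquares n)
    × (¬ SumOfThreeNonunitSquares 14) × (¬ SumOfThreeNonunitSquares 19)
theorem2p4 =
    (λ n _ n%5≡4 squares ≢14 ≢19 →
      let (a , b , c , n≡a²+b²+c²) = sumOfThreeSquares⇒ℕ squares in
      Equivalence.from (sumOfThreeNonunitSquares⇔ n) (nonunitSquares₃-of-squares a b c n≡a²+b²+c² n%5≡4 ≢14 ≢19))
  , ¬nonunitSquares₃-14 ∘ Equivalence.to (sumOfThreeNonunitSquares⇔ 14)
  , ¬nonunitSquares₃-19 ∘ Equivalence.to (sumOfThreeNonunitSquares⇔ 19)
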